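{- Let $g:\mathbb{N}\to\mathbb{Z}$ be an arithmetic function with $g(1)=1$, and assume $g(3)\equiv 0$ or $g(3)\equiv 1 \pmod{3}$. Define polynomials $P_n^g(x)$ by $P_0^g(x)=1$ and, for $n\ge 1$, $$P_n^g(x)=\frac{x}{n}\sum_{k=1}^{n} g(k)\,P_{n-k}^g(x).$$ Let $m\ge 3$ and let $\zeta_m$ be a primitive $m$th root of unity. Then $P_n^g(\zeta_m)\neq 0$ for all $n\in\mathbb{N}$. In particular, $P_n^g(\pm i)\neq 0$ for all $n\in\mathbb{N}$.
   Context: An arithmetic function $g:\mathbb{N}\to\mathbb{Z}$ is called normalized if $g(1)=1$. The polynomials $P_n^g$ generalize the D'Arcais polynomials (the case $g=\sigma$, the sum-of-divisors function). -}

module Defs where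

open import Level using (Level)
open import Data.Nat as ℕ using (ℕ; zero; suc)
open import Data.Integer as ℤ using (ℤ; +_)
open import Data.Rational as ℚ using (ℚ; _/_)
open import Data.List using (List; []; _∷_)
open import Data.Vec using (Vec; []; _∷_; head)
open import Data.Sum using (_⊎_)
open import Relation.Nullary using (¬_)
open import Algebra.Bundles using (CommutativeRing)

-- Polynomials with rational coefficients: coefficient lists, lowest degree first.
Poly : Set
Poly = List ℚ

infixl 6 _⊕_
_⊕_ : Poly → Poly → Poly
[] ⊕ q = q
(a ∷ p) ⊕ [] = a ∷ p
(a ∷ p) ⊕ (b ∷ q) = (a ℚ.+ b) ∷ (p ⊕ q)

scale : ℚ → Poly → Poly
scale c [] = []
scale c (a ∷ p) = (c ℚ.* a) ∷ scale c p

X* : Poly → Poly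
X* p = ℚ.0ℚ ∷ p

weighted : (ℕ → ℤ) → ℕ → List Poly → Poly
weighted g k [] = []
weighted g k (p ∷ ps) = scale (g k / 1) p ⊕ weighted g (suc k) ps

toList : ∀ {n} → Vec Poly n → List Poly
toList [] = []
toList (p ∷ ps) = p ∷ toList ps

-- Ps g n = [P_n, P_{n-1}, …, P_0]
Ps : (ℕ → ℤ) → (n : ℕ) → Vec Poly (suc n)
Ps g zero = (ℚ.1ℚ ∷ []) ∷ []
Ps g (suc n) =
  scale (+ 1 / suc n) (X* (weighted g 1 (toList (Ps g n)))) ∷ Ps g n

P : (ℕ → ℤ) → ℕ → Poly
P g n = head (Ps g n)

module _ {c ℓ : Level} (R : CommutativeRing c ℓ) where
  open CommutativeRing R

  record IsRingHomℚ (φ : ℚ → Carrier) : Set (c Level.⊔ ℓ) where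
    field
      map-1 : φ ℚ.1ℚ ≈ 1#
      map-+ : ∀ a b → φ (a ℚ.+ b) ≈ φ a + φ b
      map-* : ∀ a b → φ (a ℚ.* b) ≈ φ a * φ b

  record IsIntegralDomain : Set (c Level.⊔ ℓ) where
    field
      1≉0 : ¬ (1# ≈ 0#)
      noZeroDivisors : ∀ a b → a * b ≈ 0# → a ≈ 0# ⊎ b ≈ 0#

  pow : Carrier → ℕ → Carrier
  pow x zero = 1#
  pow x (suc k) = x * pow x k

  IsPrimitiveRoot : ℕ → Carrier → Set ℓ
  IsPrimitiveRoot m ζ = (pow ζ m ≈ 1#) × (∀ d → 1 ℕ.≤ d → d ℕ.< m → ¬ (pow ζ d ≈ 1#))
    where open import Data.Product using (_×_)

  eval : (ℚ → Carrier) → Poly → Carrier → Carrier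
  eval φ [] x = 0#
  eval φ (a ∷ p) x = φ a + x * eval φ p x

ℚ-to : {c ℓ : Level} → CommutativeRing c ℓ → Set c
ℚ-to R = ℚ → CommutativeRing.Carrier R

module Submission where

-- Write A n = n! Pₙ(ζ).  Clearing denominators in the recursion shows that every A n lies in ℤ[ζ] and
-- that A (n+1) = ζ Σ_k g(k) n(n−1)⋯(n−k+2) A (n+1−k).  Modulo p ∈ {2, 3} the falling factorials of
-- length ≥ 3 vanish and the others only depend on n mod p, so A (r + kp) ≡ c_r Xᵏ (mod p) with
-- c_r ∈ {1, ζ, ζ(ζ + g(2))} and X = ζ(ζ + g(2)) for p = 2, X = ζ(ζ² − g(3)) for p = 3.
-- If m has an odd divisor q > 1 take p = 2, otherwise m = 2^(i+2) and take p = 3.  Then some power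
-- ω ≠ 1 of ζ² has ω^q = 1 with q invertible mod p, which makes 1 − ω, hence 1 − ζ² and 1 ± ζ, units
-- mod p; therefore so are ζ + g(2) and, because g(3) ≡ 0 or 1, also ζ² − g(3) ∈ {ζ², −(1 + ζ)(1 − ζ)}.
-- Finally p is not a unit of ℤ[ζ], which is a finitely generated ℤ-module (the determinant trick),
-- so nothing congruent to a unit mod p vanishes.

open import Defs
open import Level using (Level; _⊔_)
open import Data.Nat.Base as ℕ using (ℕ; zero; suc; _≤_; _<_; z≤n; s≤s; NonZero; _!)
import Data.Nat.Properties as ℕ
import Data.Nat.DivMod as ℕ
open import Data.Nat.Induction using (<-wellFounded)
open import Induction.WellFounded using (Acc; acc)
import Data.Fin.Properties as Fin
open import Data.Nat.Divisibility using (_∣_; divides; n∣m*n; ∣m⇒∣m*n; ∣n⇒∣m*n)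
open import Data.Integer.Base as ℤ using (ℤ; +_; _%ℕ_)
import Data.Integer.Properties as ℤ
import Data.Integer.DivMod as ℤ
open import Data.Integer.Tactic.RingSolver using (solve-∀)
import Data.Nat.Tactic.RingSolver as ℕ-Solver
open import Data.Rational.Base as ℚ using (ℚ; _/_)
import Data.Rational.Properties as ℚ
import Data.Rational.Unnormalised.Base as ℚᵘ
import Data.Rational.Unnormalised.Properties as ℚᵘ
open import Data.List.Base using (List; []; _∷_; map)
open import Data.Fin.Base using (Fin; zero; suc; toℕ; fromℕ; inject₁)
open import Data.Vec.Functional using (Vector)
open import Data.Product.Base using (∃; ∃₂; _×_; _,_; proj₁; proj₂)
open import Data.Sum.Base using (_⊎_; inj₁; inj₂)
open import Data.Maybe.Base using (just; nothing)
open import Relation.Binary.PropositionalEquality as ≡ using (_≡_; _≢_; cong)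
open import Relation.Binary.Definitions using (WeaklyDecidable)
open import Relation.Binary.Structures using (IsPreorder)
import Relation.Binary.Reasoning.Base.Double
import Relation.Binary.Reasoning.Setoid
open import Relation.Nullary using (¬_; yes; no; contradiction)
open import Algebra.Bundles using (CommutativeRing)

fromℤ : ℤ → ℚ
fromℤ z = z / 1

toℚᵘ-fromℤ : ∀ z → ℚ.toℚᵘ (fromℤ z) ℚᵘ.≃ ℚᵘ.mkℚᵘ z 0
toℚᵘ-fromℤ z = ℚ.toℚᵘ-fromℚᵘ (ℚᵘ.mkℚᵘ z 0)

fromℤ-homo-+ : ∀ a b → fromℤ (a ℤ.+ b) ≡ fromℤ a ℚ.+ fromℤ b
fromℤ-homo-+ a b = ℚ.toℚᵘ-injective (begin
  ℚ.toℚᵘ (fromℤ (a ℤ.+ b))                     ≈⟨ toℚᵘ-fromℤ (a ℤ.+ b) ⟩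
  ℚᵘ.mkℚᵘ (a ℤ.+ b) 0                            ≈⟨ ℚᵘ.*≡* (numerators a b) ⟩
  ℚᵘ.mkℚᵘ a 0 ℚᵘ.+ ℚᵘ.mkℚᵘ b 0                  ≈⟨ ℚᵘ.+-cong (toℚᵘ-fromℤ a) (toℚᵘ-fromℤ b) ⟨
  ℚ.toℚᵘ (fromℤ a) ℚᵘ.+ ℚ.toℚᵘ (fromℤ b)        ≈⟨ ℚ.toℚᵘ-homo-+ (fromℤ a) (fromℤ b) ⟨
  ℚ.toℚᵘ (fromℤ a ℚ.+ fromℤ b)                 ∎)
  where
  open ℚᵘ.≃-Reasoning
  numerators : ∀ a b → (a ℤ.+ b) ℤ.* + 1 ≡ (a ℤ.* + 1 ℤ.+ b ℤ.* + 1) ℤ.* + 1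
  numerators = solve-∀

fromℤ-homo-* : ∀ a b → fromℤ (a ℤ.* b) ≡ fromℤ a ℚ.* fromℤ b
fromℤ-homo-* a b = ℚ.toℚᵘ-injective (begin
  ℚ.toℚᵘ (fromℤ (a ℤ.* b))                     ≈⟨ toℚᵘ-fromℤ (a ℤ.* b) ⟩
  ℚᵘ.mkℚᵘ a 0 ℚᵘ.* ℚᵘ.mkℚᵘ b 0                  ≈⟨ ℚᵘ.*-cong (toℚᵘ-fromℤ a) (toℚᵘ-fromℤ b) ⟨
  ℚ.toℚᵘ (fromℤ a) ℚᵘ.* ℚ.toℚᵘ (fromℤ b)        ≈⟨ ℚ.toℚᵘ-homo-* (fromℤ a) (fromℤ b) ⟨
  ℚ.toℚᵘ (fromℤ a ℚ.* fromℤ b)                 ∎)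
  where open ℚᵘ.≃-Reasoning

fromℤ[1+n]*[1/1+n]≡1 : ∀ n → fromℤ (+ suc n) ℚ.* (+ 1 / suc n) ≡ ℚ.1ℚ
fromℤ[1+n]*[1/1+n]≡1 n = ℚ.toℚᵘ-injective (begin
  ℚ.toℚᵘ (fromℤ (+ suc n) ℚ.* (+ 1 / suc n))
    ≈⟨ ℚ.toℚᵘ-homo-* (fromℤ (+ suc n)) (+ 1 / suc n) ⟩
  ℚ.toℚᵘ (fromℤ (+ suc n)) ℚᵘ.* ℚ.toℚᵘ (+ 1 / suc n)
    ≈⟨ ℚᵘ.*-cong (toℚᵘ-fromℤ (+ suc n)) (ℚ.toℚᵘ-fromℚᵘ (ℚᵘ.mkℚᵘ (+ 1) n)) ⟩
  ℚᵘ.mkℚᵘ (+ suc n) 0 ℚᵘ.* ℚᵘ.mkℚᵘ (+ 1) n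
    ≈⟨ ℚᵘ.*≡* denominators ⟩
  ℚᵘ.1ℚᵘ                                                ∎)
  where
  open ℚᵘ.≃-Reasoning
  denominators : (+ suc n ℤ.* + 1) ℤ.* + 1 ≡ + 1 ℤ.* + (1 ℕ.* suc n)
  denominators = ≡.trans (ℤ.*-identityʳ _) (≡.trans (ℤ.*-identityʳ _)
    (≡.sym (≡.trans (ℤ.*-identityˡ _) (cong +_ (ℕ.*-identityˡ (suc n))))))

fromℤ-≢0 : ∀ {a} → a ≢ + 0 → fromℤ a ≢ ℚ.0ℚ
fromℤ-≢0 {a} a≢0 eq with ℚᵘ.≃-trans (ℚᵘ.≃-sym (toℚᵘ-fromℤ a)) (ℚ.toℚᵘ-cong eq)
... | ℚᵘ.*≡* a*1≡0 = a≢0 (≡.trans (≡.sym (ℤ.*-identityʳ a)) a*1≡0)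

1+p*t≢0 : ∀ {p} t → p ≢ 1 → + 1 ℤ.+ + p ℤ.* t ≢ + 0
1+p*t≢0 {p} t p≢1 1+pt≡0 = p≢1 (ℕ.m*n≡1⇒m≡1 p ℤ.∣ t ∣ (≡.trans (≡.sym (ℤ.abs-* (+ p) t)) (cong ℤ.∣_∣ pt≡-1)))
  where
  shift : ∀ a → a ≡ (+ 1 ℤ.+ a) ℤ.- + 1
  shift = solve-∀
  pt≡-1 : + p ℤ.* t ≡ ℤ.- + 1
  pt≡-1 = ≡.trans (shift (+ p ℤ.* t)) (cong (ℤ._- + 1) 1+pt≡0)

2-adic : ∀ m → ∃₂ λ j s → suc m ≡ 2 ℕ.^ j ℕ.* suc (2 ℕ.* s)
2-adic m = go m (<-wellFounded m)
  where
  odd : ∀ h → suc (h ℕ.* 2) ≡ 1 ℕ.* suc (2 ℕ.* h)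
  odd = ℕ-Solver.solve-∀
  double : ∀ h → suc (suc (h ℕ.* 2)) ≡ 2 ℕ.* suc h
  double = ℕ-Solver.solve-∀
  go : ∀ m → Acc _<_ m → ∃₂ λ j s → suc m ≡ 2 ℕ.^ j ℕ.* suc (2 ℕ.* s)
  go m (acc rec) with m ℕ.% 2 | ℕ.m%n<n m 2 | ℕ.m≡m%n+[m/n]*n m 2
  ... | 0           | _            | m≡h*2   = 0 , m ℕ./ 2 , ≡.trans (cong suc m≡h*2) (odd (m ℕ./ 2))
  ... | suc (suc _) | s≤s (s≤s ()) | _
  ... | 1           | _            | m≡1+h*2
    with go (m ℕ./ 2) (rec (≡.subst (m ℕ./ 2 <_) (≡.sym m≡1+h*2) (s≤s (ℕ.m≤m*n (m ℕ./ 2) 2))))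
  ... | j , s , 1+h≡2ʲq = suc j , s , (begin
    suc m                              ≡⟨ cong suc m≡1+h*2 ⟩
    suc (suc (m ℕ./ 2 ℕ.* 2))          ≡⟨ double (m ℕ./ 2) ⟩
    2 ℕ.* suc (m ℕ./ 2)                ≡⟨ cong (2 ℕ.*_) 1+h≡2ʲq ⟩
    2 ℕ.* (2 ℕ.^ j ℕ.* suc (2 ℕ.* s))  ≡⟨ ℕ.*-assoc 2 (2 ℕ.^ j) _ ⟨
    2 ℕ.^ suc j ℕ.* suc (2 ℕ.* s)      ∎)
    where open ≡.≡-Reasoning

module _ {c ℓ} (R : CommutativeRing c ℓ) (φ : ℚ-to R) (φ-hom : IsRingHomℚ R φ) where
  open CommutativeRing R hiding (zero)
  open IsRingHomℚ φ-hom
  open import Algebra.Properties.Group +-group using (identityʳ-unique; inverseʳ-unique)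
  open import Algebra.Solver.Ring.AlmostCommutativeRing
    using (fromCommutativeRing; _-Raw-AlmostCommutative⟶_; Induced-equivalence)
  open import Algebra.Properties.Semiring.Exp semiring using (_^_; ^-assocʳ; ^-congˡ)
  open import Algebra.Properties.Monoid.Sum +-monoid using (sum-syntax; sum-cong-≋; sum-init-last; sum-replicate-zero)
  open import Algebra.Properties.Semiring.Sum semiring using (∑-distrib-+; *-distribˡ-sum)
  module ≈-Reasoning = Relation.Binary.Reasoning.Setoid setoid

  -- ι 0 and ι 1 reduce to 0# and 1#, so that the constants 0 and 1 of the ring solver are literally
  -- the ring's.
  ι : ℤ → Carrier
  ι (+ 0) = 0#
  ι (+ 1) = 1#
  ι z     = φ (fromℤ z)

  ι≈φ∘fromℤ : ∀ z → ι z ≈ φ (fromℤ z)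
  ι≈φ∘fromℤ (+ 0)          = sym (identityʳ-unique (φ ℚ.0ℚ) (φ ℚ.0ℚ) (sym (map-+ ℚ.0ℚ ℚ.0ℚ)))
  ι≈φ∘fromℤ (+ 1)          = sym map-1
  ι≈φ∘fromℤ (+ suc (suc n)) = refl
  ι≈φ∘fromℤ ℤ.-[1+ n ]     = refl

  ιn : ℕ → Carrier
  ιn n = ι (+ n)

  ι-homo-+ : ∀ a b → ι (a ℤ.+ b) ≈ ι a + ι b
  ι-homo-+ a b = begin
    ι (a ℤ.+ b)                ≈⟨ ι≈φ∘fromℤ (a ℤ.+ b) ⟩
    φ (fromℤ (a ℤ.+ b))        ≈⟨ reflexive (cong φ (fromℤ-homo-+ a b)) ⟩
    φ (fromℤ a ℚ.+ fromℤ b)    ≈⟨ map-+ _ _ ⟩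
    φ (fromℤ a) + φ (fromℤ b)  ≈⟨ +-cong (ι≈φ∘fromℤ a) (ι≈φ∘fromℤ b) ⟨
    ι a + ι b                  ∎
    where open ≈-Reasoning

  ι-homo-* : ∀ a b → ι (a ℤ.* b) ≈ ι a * ι b
  ι-homo-* a b = begin
    ι (a ℤ.* b)                ≈⟨ ι≈φ∘fromℤ (a ℤ.* b) ⟩
    φ (fromℤ (a ℤ.* b))        ≈⟨ reflexive (cong φ (fromℤ-homo-* a b)) ⟩
    φ (fromℤ a ℚ.* fromℤ b)    ≈⟨ map-* _ _ ⟩
    φ (fromℤ a) * φ (fromℤ b)  ≈⟨ *-cong (ι≈φ∘fromℤ a) (ι≈φ∘fromℤ b) ⟨
    ι a * ι b                  ∎
    where open ≈-Reasoning

  ι-homo-neg : ∀ a → ι (ℤ.- a) ≈ - ι a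
  ι-homo-neg a = inverseʳ-unique (ι a) (ι (ℤ.- a))
    (trans (sym (ι-homo-+ a (ℤ.- a))) (reflexive (cong ι (ℤ.+-inverseʳ a))))

  ιn-homo-+ : ∀ m n → ιn (m ℕ.+ n) ≈ ιn m + ιn n
  ιn-homo-+ m n = trans (reflexive (cong ι (ℤ.pos-+ m n))) (ι-homo-+ (+ m) (+ n))

  ιn-homo-* : ∀ m n → ιn (m ℕ.* n) ≈ ιn m * ιn n
  ιn-homo-* m n = trans (reflexive (cong ι (ℤ.pos-* m n))) (ι-homo-* (+ m) (+ n))

  ι-morphism : ℤ.+-*-rawRing -Raw-AlmostCommutative⟶ fromCommutativeRing R
  ι-morphism = record
    { ⟦_⟧ = ι ; +-homo = ι-homo-+ ; *-homo = ι-homo-* ; -‿homo = ι-homo-neg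
    ; 0-homo = refl ; 1-homo = refl }

  ι-≟ : WeaklyDecidable (Induced-equivalence ι-morphism)
  ι-≟ a b with a ℤ.≟ b
  ... | yes a≡b = just (reflexive (cong ι a≡b))
  ... | no _    = nothing

  open import Algebra.Solver.Ring ℤ.+-*-rawRing (fromCommutativeRing R) ι-morphism ι-≟ public
    using (solve; _:=_; _:+_; _:*_; :-_; _:-_; _:^_; con)

  ι-cancelˡ : ∀ {a x} → a ≢ + 0 → ι a * x ≈ 0# → x ≈ 0#
  ι-cancelˡ {a} {x} a≢0 ax≈0 = begin
    x                  ≈⟨ *-identityˡ x ⟨
    1# * x             ≈⟨ *-congʳ ι[a]*u≈1 ⟨
    (ι a * u) * x      ≈⟨ solve 3 (λ A U X → (A :* U) :* X := U :* (A :* X)) refl (ι a) u x ⟩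
    u * (ι a * x)      ≈⟨ *-congˡ ax≈0 ⟩
    u * 0#             ≈⟨ zeroʳ u ⟩
    0#                 ∎
    where
    open ≈-Reasoning
    instance _ = ℚ.≢-nonZero (fromℤ-≢0 a≢0)
    u = φ (ℚ.1/ fromℤ a)
    ι[a]*u≈1 : ι a * u ≈ 1#
    ι[a]*u≈1 = begin
      ι a * u                   ≈⟨ *-congʳ (ι≈φ∘fromℤ a) ⟩
      φ (fromℤ a) * u           ≈⟨ map-* _ _ ⟨
      φ (fromℤ a ℚ.* ℚ.1/ fromℤ a) ≈⟨ reflexive (cong φ (ℚ.*-inverseʳ (fromℤ a))) ⟩
      φ ℚ.1ℚ                    ≈⟨ map-1 ⟩
      1#                        ∎

  ιn[1+n]*φ[1/1+n]≈1 : ∀ n → ιn (suc n) * φ (+ 1 / suc n) ≈ 1#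
  ιn[1+n]*φ[1/1+n]≈1 n = begin
    ιn (suc n) * φ (+ 1 / suc n)              ≈⟨ *-congʳ (ι≈φ∘fromℤ (+ suc n)) ⟩
    φ (fromℤ (+ suc n)) * φ (+ 1 / suc n)     ≈⟨ map-* _ _ ⟨
    φ (fromℤ (+ suc n) ℚ.* (+ 1 / suc n))     ≈⟨ reflexive (cong φ (fromℤ[1+n]*[1/1+n]≡1 n)) ⟩
    φ ℚ.1ℚ                                    ≈⟨ map-1 ⟩
    1#                                        ∎
    where open ≈-Reasoning

  module Evaluation (x : Carrier) where
    open ≈-Reasoning

    ⟦_⟧ : Poly → Carrier
    ⟦ f ⟧ = eval R φ f x

    eval-⊕ : ∀ f h → ⟦ f ⊕ h ⟧ ≈ ⟦ f ⟧ + ⟦ h ⟧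
    eval-⊕ []      h       = sym (+-identityˡ _)
    eval-⊕ (a ∷ f) []      = sym (+-identityʳ _)
    eval-⊕ (a ∷ f) (b ∷ h) = begin
      φ (a ℚ.+ b) + x * ⟦ f ⊕ h ⟧
        ≈⟨ +-cong (map-+ a b) (*-congˡ (eval-⊕ f h)) ⟩
      (φ a + φ b) + x * (⟦ f ⟧ + ⟦ h ⟧)
        ≈⟨ solve 5 (λ A B X F H → (A :+ B) :+ X :* (F :+ H) := (A :+ X :* F) :+ (B :+ X :* H)) refl (φ a) (φ b) x ⟦ f ⟧ ⟦ h ⟧ ⟩
      (φ a + x * ⟦ f ⟧) + (φ b + x * ⟦ h ⟧) ∎

    eval-scale : ∀ a f → ⟦ scale a f ⟧ ≈ φ a * ⟦ f ⟧
    eval-scale a []      = sym (zeroʳ _)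
    eval-scale a (b ∷ f) = begin
      φ (a ℚ.* b) + x * ⟦ scale a f ⟧
        ≈⟨ +-cong (map-* a b) (*-congˡ (eval-scale a f)) ⟩
      φ a * φ b + x * (φ a * ⟦ f ⟧)
        ≈⟨ solve 4 (λ A B X F → A :* B :+ X :* (A :* F) := A :* (B :+ X :* F)) refl (φ a) (φ b) x ⟦ f ⟧ ⟩
      φ a * (φ b + x * ⟦ f ⟧)             ∎

    eval-X* : ∀ f → ⟦ X* f ⟧ ≈ x * ⟦ f ⟧
    eval-X* f = trans (+-congʳ (sym (ι≈φ∘fromℤ (+ 0)))) (+-identityˡ _)

  module IntegerPolynomials (ζ : Carrier) where
    open ≈-Reasoning

    ⟦_⟧ℤ : List ℤ → Carrier
    ⟦ []     ⟧ℤ = 0#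
    ⟦ a ∷ cs ⟧ℤ = ι a + ζ * ⟦ cs ⟧ℤ

    infix 4 _∈ℤ[ζ]
    _∈ℤ[ζ] : Carrier → Set ℓ
    x ∈ℤ[ζ] = ∃ λ cs → x ≈ ⟦ cs ⟧ℤ

    ∈-resp-≈ : ∀ {x y} → x ≈ y → x ∈ℤ[ζ] → y ∈ℤ[ζ]
    ∈-resp-≈ x≈y (cs , x≈cs) = cs , trans (sym x≈y) x≈cs

    ∈-0 : 0# ∈ℤ[ζ]
    ∈-0 = [] , refl

    ∈-ι : ∀ a → ι a ∈ℤ[ζ]
    ∈-ι a = a ∷ [] , sym (trans (+-congˡ (zeroʳ ζ)) (+-identityʳ _))

    ∈-1 : 1# ∈ℤ[ζ]
    ∈-1 = ∈-ι (+ 1)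

    ∈-ζ* : ∀ {x} → x ∈ℤ[ζ] → ζ * x ∈ℤ[ζ]
    ∈-ζ* (cs , x≈cs) = + 0 ∷ cs , sym (trans (+-identityˡ _) (*-congˡ (sym x≈cs)))

    ∈-ζ : ζ ∈ℤ[ζ]
    ∈-ζ = ∈-resp-≈ (*-identityʳ ζ) (∈-ζ* ∈-1)

    _⊞_ : List ℤ → List ℤ → List ℤ
    []       ⊞ ds       = ds
    (a ∷ cs) ⊞ []       = a ∷ cs
    (a ∷ cs) ⊞ (b ∷ ds) = (a ℤ.+ b) ∷ (cs ⊞ ds)

    ⟦⊞⟧ : ∀ cs ds → ⟦ cs ⊞ ds ⟧ℤ ≈ ⟦ cs ⟧ℤ + ⟦ ds ⟧ℤ
    ⟦⊞⟧ []       ds       = sym (+-identityˡ _)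
    ⟦⊞⟧ (a ∷ cs) []       = sym (+-identityʳ _)
    ⟦⊞⟧ (a ∷ cs) (b ∷ ds) = begin
      ι (a ℤ.+ b) + ζ * ⟦ cs ⊞ ds ⟧ℤ
        ≈⟨ +-cong (ι-homo-+ a b) (*-congˡ (⟦⊞⟧ cs ds)) ⟩
      (ι a + ι b) + ζ * (⟦ cs ⟧ℤ + ⟦ ds ⟧ℤ)
        ≈⟨ solve 5 (λ A B Z C D → (A :+ B) :+ Z :* (C :+ D) := (A :+ Z :* C) :+ (B :+ Z :* D)) refl (ι a) (ι b) ζ ⟦ cs ⟧ℤ ⟦ ds ⟧ℤ ⟩
      (ι a + ζ * ⟦ cs ⟧ℤ) + (ι b + ζ * ⟦ ds ⟧ℤ) ∎

    ∈-+ : ∀ {x y} → x ∈ℤ[ζ] → y ∈ℤ[ζ] → x + y ∈ℤ[ζ]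
    ∈-+ (cs , x≈cs) (ds , y≈ds) = cs ⊞ ds , trans (+-cong x≈cs y≈ds) (sym (⟦⊞⟧ cs ds))

    ⟦map-a*⟧ : ∀ a cs → ⟦ map (a ℤ.*_) cs ⟧ℤ ≈ ι a * ⟦ cs ⟧ℤ
    ⟦map-a*⟧ a []       = sym (zeroʳ _)
    ⟦map-a*⟧ a (b ∷ cs) = begin
      ι (a ℤ.* b) + ζ * ⟦ map (a ℤ.*_) cs ⟧ℤ
        ≈⟨ +-cong (ι-homo-* a b) (*-congˡ (⟦map-a*⟧ a cs)) ⟩
      ι a * ι b + ζ * (ι a * ⟦ cs ⟧ℤ)
        ≈⟨ solve 4 (λ A B Z C → A :* B :+ Z :* (A :* C) := A :* (B :+ Z :* C)) refl (ι a) (ι b) ζ ⟦ cs ⟧ℤ ⟩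
      ι a * (ι b + ζ * ⟦ cs ⟧ℤ)               ∎

    ∈-ι* : ∀ a {x} → x ∈ℤ[ζ] → ι a * x ∈ℤ[ζ]
    ∈-ι* a (cs , x≈cs) = map (a ℤ.*_) cs , trans (*-congˡ x≈cs) (sym (⟦map-a*⟧ a cs))

    ∈-⟦⟧* : ∀ cs {y} → y ∈ℤ[ζ] → ⟦ cs ⟧ℤ * y ∈ℤ[ζ]
    ∈-⟦⟧* []       {y} y∈ = ∈-resp-≈ (sym (zeroˡ y)) ∈-0
    ∈-⟦⟧* (a ∷ cs) {y} y∈ = ∈-resp-≈ horner-step (∈-+ (∈-ι* a y∈) (∈-ζ* (∈-⟦⟧* cs y∈)))
      where
      horner-step : ι a * y + ζ * (⟦ cs ⟧ℤ * y) ≈ (ι a + ζ * ⟦ cs ⟧ℤ) * y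
      horner-step = solve 4 (λ A Y Z C → A :* Y :+ Z :* (C :* Y) := (A :+ Z :* C) :* Y) refl (ι a) y ζ ⟦ cs ⟧ℤ

    ∈-* : ∀ {x y} → x ∈ℤ[ζ] → y ∈ℤ[ζ] → x * y ∈ℤ[ζ]
    ∈-* (cs , x≈cs) y∈ = ∈-resp-≈ (*-congʳ (sym x≈cs)) (∈-⟦⟧* cs y∈)

    ∈-neg : ∀ {x} → x ∈ℤ[ζ] → - x ∈ℤ[ζ]
    ∈-neg {x} x∈ = ∈-resp-≈ (solve 1 (λ X → con (ℤ.- + 1) :* X := :- X) refl x) (∈-ι* (ℤ.- + 1) x∈)

    ∈-^ : ∀ {x} → x ∈ℤ[ζ] → ∀ n → x ^ n ∈ℤ[ζ]
    ∈-^ x∈ zero    = ∈-1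
    ∈-^ x∈ (suc n) = ∈-* x∈ (∈-^ x∈ n)

  geom : Carrier → ℕ → Carrier
  geom x zero    = 0#
  geom x (suc n) = 1# + x * geom x n

  geomSum : Carrier → ℕ → Carrier
  geomSum x zero    = 0#
  geomSum x (suc n) = geomSum x n + geom x n

  [1-x]geom≈1-xⁿ : ∀ x n → (1# - x) * geom x n ≈ 1# - x ^ n
  [1-x]geom≈1-xⁿ x zero    = trans (zeroʳ _) (sym (-‿inverseʳ 1#))
  [1-x]geom≈1-xⁿ x (suc n) = begin
    (1# - x) * (1# + x * geom x n)
      ≈⟨ solve 2 (λ X G → (con (+ 1) :- X) :* (con (+ 1) :+ X :* G) := (con (+ 1) :- X) :+ X :* ((con (+ 1) :- X) :* G)) refl x (geom x n) ⟩
    (1# - x) + x * ((1# - x) * geom x n)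
      ≈⟨ +-congˡ (*-congˡ ([1-x]geom≈1-xⁿ x n)) ⟩
    (1# - x) + x * (1# - x ^ n)
      ≈⟨ solve 2 (λ X Y → (con (+ 1) :- X) :+ X :* (con (+ 1) :- Y) := con (+ 1) :- X :* Y) refl x (x ^ n) ⟩
    1# - x * x ^ n                      ∎
    where open ≈-Reasoning

  [1-x]geomSum≈n-geom : ∀ x n → (1# - x) * geomSum x n ≈ ιn n - geom x n
  [1-x]geomSum≈n-geom x zero    = trans (zeroʳ _) (sym (-‿inverseʳ 0#))
  [1-x]geomSum≈n-geom x (suc n) = begin
    (1# - x) * (geomSum x n + geom x n)
      ≈⟨ distribˡ _ _ _ ⟩
    (1# - x) * geomSum x n + (1# - x) * geom x n
      ≈⟨ +-congʳ ([1-x]geomSum≈n-geom x n) ⟩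
    (ιn n - geom x n) + (1# - x) * geom x n
      ≈⟨ solve 3 (λ X N G → (N :- G) :+ (con (+ 1) :- X) :* G := (con (+ 1) :+ N) :- (con (+ 1) :+ X :* G)) refl x (ιn n) (geom x n) ⟩
    (1# + ιn n) - (1# + x * geom x n)
      ≈⟨ +-congʳ (ιn-homo-+ 1 n) ⟨
    ιn (suc n) - geom x (suc n)                     ∎
    where open ≈-Reasoning

  module Congruence (ζ : Carrier) (p : ℕ) where
    open IntegerPolynomials ζ

    -- The witness has to lie in ℤ[ζ]: in R itself p is invertible.
    infix 4 _≡ₚ_
    _≡ₚ_ : Carrier → Carrier → Set (c ⊔ ℓ)
    x ≡ₚ y = ∃ λ w → w ∈ℤ[ζ] × x ≈ y + ιn p * w

    ≈⇒≡ₚ : ∀ {x y} → x ≈ y → x ≡ₚ y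
    ≈⇒≡ₚ {x} {y} x≈y = 0# , ∈-0 , trans x≈y (solve 2 (λ Y P → Y := Y :+ P :* con (+ 0)) refl y (ιn p))

    ≡ₚ-refl : ∀ {x} → x ≡ₚ x
    ≡ₚ-refl = ≈⇒≡ₚ refl

    ≡ₚ-sym : ∀ {x y} → x ≡ₚ y → y ≡ₚ x
    ≡ₚ-sym {x} {y} (w , w∈ , x≈y+pw) = - w , ∈-neg w∈ , (begin
      y                         ≈⟨ solve 3 (λ Y P W → Y := (Y :+ P :* W) :+ P :* (:- W)) refl y (ιn p) w ⟩
      (y + ιn p * w) + ιn p * - w ≈⟨ +-congʳ x≈y+pw ⟨
      x + ιn p * - w            ∎)
      where open ≈-Reasoning

    ≡ₚ-trans : ∀ {x y z} → x ≡ₚ y → y ≡ₚ z → x ≡ₚ z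
    ≡ₚ-trans {x} {y} {z} (w , w∈ , x≈y+pw) (v , v∈ , y≈z+pv) = v + w , ∈-+ v∈ w∈ , (begin
      x                         ≈⟨ x≈y+pw ⟩
      y + ιn p * w              ≈⟨ +-congʳ y≈z+pv ⟩
      (z + ιn p * v) + ιn p * w ≈⟨ solve 4 (λ Z P V W → (Z :+ P :* V) :+ P :* W := Z :+ P :* (V :+ W)) refl z (ιn p) v w ⟩
      z + ιn p * (v + w)        ∎)
      where open ≈-Reasoning

    ≡ₚ-isPreorder : IsPreorder _≈_ _≡ₚ_
    ≡ₚ-isPreorder = record { isEquivalence = isEquivalence ; reflexive = ≈⇒≡ₚ ; trans = ≡ₚ-trans }

    module ≡ₚ-Reasoning = Relation.Binary.Reasoning.Base.Double ≡ₚ-isPreorder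
    open ≡ₚ-Reasoning

    +-congₚ : ∀ {x x′ y y′} → x ≡ₚ x′ → y ≡ₚ y′ → x + y ≡ₚ x′ + y′
    +-congₚ {x} {x′} {y} {y′} (w , w∈ , x≈) (v , v∈ , y≈) = w + v , ∈-+ w∈ v∈ , (begin-equality
      x + y
        ≈⟨ +-cong x≈ y≈ ⟩
      (x′ + ιn p * w) + (y′ + ιn p * v)
        ≈⟨ solve 5 (λ X Y P W V → (X :+ P :* W) :+ (Y :+ P :* V) := (X :+ Y) :+ P :* (W :+ V)) refl x′ y′ (ιn p) w v ⟩
      (x′ + y′) + ιn p * (w + v)           ∎)

    *-congˡₚ : ∀ {s x y} → s ∈ℤ[ζ] → x ≡ₚ y → s * x ≡ₚ s * y
    *-congˡₚ {s} {x} {y} s∈ (w , w∈ , x≈) = s * w , ∈-* s∈ w∈ , (begin-equality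
      s * x                   ≈⟨ *-congˡ x≈ ⟩
      s * (y + ιn p * w)      ≈⟨ solve 4 (λ S Y P W → S :* (Y :+ P :* W) := S :* Y :+ P :* (S :* W)) refl s y (ιn p) w ⟩
      s * y + ιn p * (s * w)  ∎)

    *-congʳₚ : ∀ {s x y} → s ∈ℤ[ζ] → x ≡ₚ y → x * s ≡ₚ y * s
    *-congʳₚ {s} {x} {y} s∈ x≡y =
      ≡ₚ-trans (≈⇒≡ₚ (*-comm x s)) (≡ₚ-trans (*-congˡₚ s∈ x≡y) (≈⇒≡ₚ (*-comm s y)))

    *-congₚ : ∀ {x x′ y y′} → x′ ∈ℤ[ζ] → y ∈ℤ[ζ] → x ≡ₚ y → x′ ≡ₚ y′ → x * x′ ≡ₚ y * y′
    *-congₚ x′∈ y∈ x≡y x′≡y′ = ≡ₚ-trans (*-congʳₚ x′∈ x≡y) (*-congˡₚ y∈ x′≡y′)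

    ι[a+bp]≡ₚιa : ∀ a b {s} → s ∈ℤ[ζ] → ι (a ℤ.+ b ℤ.* + p) * s ≡ₚ ι a * s
    ι[a+bp]≡ₚιa a b {s} s∈ = ι b * s , ∈-ι* b s∈ , (begin-equality
      ι (a ℤ.+ b ℤ.* + p) * s
        ≈⟨ *-congʳ (trans (ι-homo-+ a (b ℤ.* + p)) (+-congˡ (ι-homo-* b (+ p)))) ⟩
      (ι a + ι b * ιn p) * s
        ≈⟨ solve 4 (λ A B P S → (A :+ B :* P) :* S := A :* S :+ P :* (B :* S)) refl (ι a) (ι b) (ιn p) s ⟩
      ι a * s + ιn p * (ι b * s)   ∎)

    ι≡ₚι[%ℕp] : .{{_ : NonZero p}} → ∀ a {s} → s ∈ℤ[ζ] → ι a * s ≡ₚ ιn (a %ℕ p) * s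
    ι≡ₚι[%ℕp] a {s} s∈ = ≡ₚ-trans (≈⇒≡ₚ (*-congʳ (reflexive (cong ι (ℤ.a≡a%ℕn+[a/ℕn]*n a p)))))
                                  (ι[a+bp]≡ₚιa (+ (a %ℕ p)) (a ℤ./ℕ p) s∈)

    ιn[r+kp]≡ₚιnr : ∀ r k {s} → s ∈ℤ[ζ] → ιn (r ℕ.+ k ℕ.* p) * s ≡ₚ ιn r * s
    ιn[r+kp]≡ₚιnr r k s∈ = ≡ₚ-trans (≈⇒≡ₚ (*-congʳ (reflexive (cong ι lift)))) (ι[a+bp]≡ₚιa (+ r) (+ k) s∈)
      where
      lift : + (r ℕ.+ k ℕ.* p) ≡ + r ℤ.+ + k ℤ.* + p
      lift = ≡.trans (ℤ.pos-+ r (k ℕ.* p)) (cong (λ x → + r ℤ.+ x) (ℤ.pos-* k p))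

    p∣n⇒ιn*≡ₚ0 : ∀ {n s} → p ∣ n → s ∈ℤ[ζ] → ιn n * s ≡ₚ 0#
    p∣n⇒ιn*≡ₚ0 {s = s} (divides k ≡.refl) s∈ = ≡ₚ-trans (ιn[r+kp]≡ₚιnr 0 k s∈) (≈⇒≡ₚ (zeroˡ s))

    ιa*ιn[r+kp]≡ₚ : .{{_ : NonZero p}} → ∀ a r k {s} → s ∈ℤ[ζ] → ι a * (ιn (r ℕ.+ k ℕ.* p) * s) ≡ₚ ιn (a %ℕ p) * (ιn r * s)
    ιa*ιn[r+kp]≡ₚ a r k s∈ = ≡ₚ-trans (*-congˡₚ (∈-ι a) (ιn[r+kp]≡ₚιnr r k s∈)) (ι≡ₚι[%ℕp] a (∈-ι* (+ r) s∈))

    Unitₚ : Carrier → Set (c ⊔ ℓ)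
    Unitₚ x = x ∈ℤ[ζ] × ∃ λ t → t ∈ℤ[ζ] × x * t ≡ₚ 1#

    unit-resp-≡ₚ : ∀ {x y} → y ∈ℤ[ζ] → x ≡ₚ y → Unitₚ x → Unitₚ y
    unit-resp-≡ₚ y∈ x≡y (_ , t , t∈ , xt≡1) = y∈ , t , t∈ , ≡ₚ-trans (*-congʳₚ t∈ (≡ₚ-sym x≡y)) xt≡1

    unit-resp-≈ : ∀ {x y} → x ≈ y → Unitₚ x → Unitₚ y
    unit-resp-≈ x≈y u = unit-resp-≡ₚ (∈-resp-≈ x≈y (proj₁ u)) (≈⇒≡ₚ x≈y) u

    unit-1 : Unitₚ 1#
    unit-1 = ∈-1 , 1# , ∈-1 , ≈⇒≡ₚ (*-identityˡ 1#)

    unit-* : ∀ {x y} → Unitₚ x → Unitₚ y → Unitₚ (x * y)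
    unit-* {x} {y} (x∈ , t , t∈ , xt≡1) (y∈ , u , u∈ , yu≡1) = ∈-* x∈ y∈ , t * u , ∈-* t∈ u∈ , (begin
      (x * y) * (t * u)  ≈⟨ solve 4 (λ X Y T U → (X :* Y) :* (T :* U) := (X :* T) :* (Y :* U)) refl x y t u ⟩
      (x * t) * (y * u)  ≲⟨ *-congₚ (∈-* y∈ u∈) ∈-1 xt≡1 yu≡1 ⟩
      1# * 1#            ≈⟨ *-identityˡ 1# ⟩
      1#                 ∎)

    unit-^ : ∀ {x} → Unitₚ x → ∀ n → Unitₚ (x ^ n)
    unit-^ u zero    = unit-1
    unit-^ u (suc n) = unit-* u (unit-^ u n)

    unit-neg : ∀ {x} → Unitₚ x → Unitₚ (- x)
    unit-neg {x} (x∈ , t , t∈ , xt≡1) = ∈-neg x∈ , - t , ∈-neg t∈ ,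
      ≡ₚ-trans (≈⇒≡ₚ (solve 2 (λ X T → (:- X) :* (:- T) := X :* T) refl x t)) xt≡1

    unit-factorˡ : ∀ {x y} → x ∈ℤ[ζ] → y ∈ℤ[ζ] → Unitₚ (x * y) → Unitₚ x
    unit-factorˡ x∈ y∈ (_ , t , t∈ , xyt≡1) = x∈ , _ , ∈-* y∈ t∈ , ≡ₚ-trans (≈⇒≡ₚ (sym (*-assoc _ _ _))) xyt≡1

    geom∈ : ∀ {x} → x ∈ℤ[ζ] → ∀ n → geom x n ∈ℤ[ζ]
    geom∈ x∈ zero    = ∈-0
    geom∈ x∈ (suc n) = ∈-+ ∈-1 (∈-* x∈ (geom∈ x∈ n))

    geomSum∈ : ∀ {x} → x ∈ℤ[ζ] → ∀ n → geomSum x n ∈ℤ[ζ]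
    geomSum∈ x∈ zero    = ∈-0
    geomSum∈ x∈ (suc n) = ∈-+ (geomSum∈ x∈ n) (geom∈ x∈ n)

    -- With ω ≠ 1 a q-th root of unity, Σ_{i<q} ωⁱ = 0, so q = Σ_{i<q} (1 − ωⁱ) is a multiple of 1 − ω
    -- in ℤ[ζ]; it is invertible mod p whenever q is.
    unit-1-ω : IsIntegralDomain R → ∀ {ω} q r t → ω ∈ℤ[ζ] → ω ^ q ≈ 1# → ¬ ω ≈ 1# →
               q ℕ.* r ≡ 1 ℕ.+ t ℕ.* p → Unitₚ (1# - ω)
    unit-1-ω dom {ω} q r t ω∈ ω^q≈1 ω≉1 qr≡1+tp =
      ∈-+ ∈-1 (∈-neg ω∈) , ιn r * geomSum ω q , ∈-ι* (+ r) (geomSum∈ ω∈ q) , (begin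
        (1# - ω) * (ιn r * geomSum ω q)
          ≈⟨ solve 3 (λ W Rr S → (con (+ 1) :- W) :* (Rr :* S) := Rr :* ((con (+ 1) :- W) :* S)) refl ω (ιn r) (geomSum ω q) ⟩
        ιn r * ((1# - ω) * geomSum ω q)
          ≈⟨ *-congˡ (trans ([1-x]geomSum≈n-geom ω q) (+-congˡ (-‿cong geom≈0))) ⟩
        ιn r * (ιn q - 0#)
          ≈⟨ solve 2 (λ Rr Q → Rr :* (Q :- con (+ 0)) := Q :* Rr :* con (+ 1)) refl (ιn r) (ιn q) ⟩
        (ιn q * ιn r) * 1#
          ≈⟨ *-congʳ (trans (sym (ιn-homo-* q r)) (reflexive (cong ιn qr≡1+tp))) ⟩
        ιn (1 ℕ.+ t ℕ.* p) * 1#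
          ≲⟨ ιn[r+kp]≡ₚιnr 1 t ∈-1 ⟩
        1# * 1#
          ≈⟨ *-identityˡ 1# ⟩
        1#                               ∎)
      where
      open IsIntegralDomain dom
      1-ω≉0 : ¬ 1# - ω ≈ 0#
      1-ω≉0 1-ω≈0 = ω≉1 (begin-equality
        ω              ≈⟨ solve 1 (λ W → W := con (+ 1) :- (con (+ 1) :- W)) refl ω ⟩
        1# - (1# - ω)  ≈⟨ +-congˡ (-‿cong 1-ω≈0) ⟩
        1# - 0#        ≈⟨ solve 0 (con (+ 1) :- con (+ 0) := con (+ 1)) refl ⟩
        1#             ∎)
      geom≈0 : geom ω q ≈ 0#
      geom≈0 with noZeroDivisors _ _ (trans ([1-x]geom≈1-xⁿ ω q) (trans (+-congˡ (-‿cong ω^q≈1)) (-‿inverseʳ 1#)))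
      ... | inj₁ 1-ω≈0 = contradiction 1-ω≈0 1-ω≉0
      ... | inj₂ g≈0   = g≈0

    unit-1-x : ∀ {x} n → x ∈ℤ[ζ] → Unitₚ (1# - x ^ n) → Unitₚ (1# - x)
    unit-1-x {x} n x∈ u = unit-factorˡ (∈-+ ∈-1 (∈-neg x∈)) (geom∈ x∈ n) (unit-resp-≈ (sym ([1-x]geom≈1-xⁿ x n)) u)

    unit-ζ+ιn : ∀ {e} → e < 2 → Unitₚ ζ → Unitₚ (1# + ζ) → Unitₚ (ζ + ιn e)
    unit-ζ+ιn {0} _ uζ _   = unit-resp-≈ (sym (+-identityʳ ζ)) uζ
    unit-ζ+ιn {1} _ _ u1+ζ = unit-resp-≈ (+-comm 1# ζ) u1+ζ
    unit-ζ+ιn {suc (suc _)} (s≤s (s≤s ()))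

    unit-1±ζ : IsIntegralDomain R → ∀ N q r t → ¬ (ζ ^ 2) ^ N ≈ 1# → ((ζ ^ 2) ^ N) ^ q ≈ 1# →
               q ℕ.* r ≡ 1 ℕ.+ t ℕ.* p → Unitₚ (1# + ζ) × Unitₚ (1# - ζ)
    unit-1±ζ dom N q r t ω≉1 ω^q≈1 qr≡1+tp = unit-factorˡ 1+ζ∈ 1-ζ∈ (unit-resp-≈ difference-of-squares u)
               , unit-factorˡ 1-ζ∈ 1+ζ∈ (unit-resp-≈ (trans difference-of-squares (*-comm _ _)) u)
      where
      u : Unitₚ (1# - ζ ^ 2)
      u = unit-1-x N (∈-^ ∈-ζ 2) (unit-1-ω dom q r t (∈-^ (∈-^ ∈-ζ 2) N) ω^q≈1 ω≉1 qr≡1+tp)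
      1+ζ∈ = ∈-+ ∈-1 ∈-ζ
      1-ζ∈ = ∈-+ ∈-1 (∈-neg ∈-ζ)
      difference-of-squares : 1# - ζ ^ 2 ≈ (1# + ζ) * (1# - ζ)
      difference-of-squares = solve 1 (λ Z → con (+ 1) :- Z :^ 2 := (con (+ 1) :+ Z) :* (con (+ 1) :- Z)) refl ζ

  ∑≈0 : ∀ {m} (f : Vector Carrier m) → (∀ j → f j ≈ 0#) → ∑[ j < m ] f j ≈ 0#
  ∑≈0 {m} f f≈0 = trans (sum-cong-≋ {m} f≈0) (sum-replicate-zero m)

  module Elimination (p : ℕ) (p≢1 : p ≢ 1) where
    private
      p̂ : Carrier
      p̂ = ιn p

      -- One step of Gaussian elimination: row 0 gives e · v₀ = p · (…) with e = 1 + p (k − C₀₀),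
      -- and substituting it into e times the other rows yields a system of the same shape for the
      -- remaining coordinates.
      module Step {n} (v : Vector Carrier (suc n)) (C : Fin (suc n) → Fin (suc n) → ℤ) (k : ℤ)
                  (hyp : ∀ i → ι (+ 1 ℤ.+ + p ℤ.* k) * v i ≈ p̂ * ∑[ j < suc n ] (ι (C i j) * v j)) where
        open ≈-Reasoning

        D : Carrier
        D = ι (+ 1 ℤ.+ + p ℤ.* k)

        S : Fin (suc n) → Carrier
        S i = ∑[ j < n ] (ι (C i (suc j)) * v (suc j))

        e : ℤ
        e = + 1 ℤ.+ + p ℤ.* (k ℤ.- C zero zero)

        e≢0 : e ≢ + 0
        e≢0 = 1+p*t≢0 (k ℤ.- C zero zero) p≢1

        ιe≈D-pC₀₀ : ι e ≈ D - p̂ * ι (C zero zero)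
        ιe≈D-pC₀₀ = begin
          ι e
            ≈⟨ reflexive (cong ι (regroup (+ p) k (C zero zero))) ⟩
          ι ((+ 1 ℤ.+ + p ℤ.* k) ℤ.+ ℤ.- (+ p ℤ.* C zero zero))
            ≈⟨ ι-homo-+ (+ 1 ℤ.+ + p ℤ.* k) (ℤ.- (+ p ℤ.* C zero zero)) ⟩
          D + ι (ℤ.- (+ p ℤ.* C zero zero))
            ≈⟨ +-congˡ (trans (ι-homo-neg (+ p ℤ.* C zero zero)) (-‿cong (ι-homo-* (+ p) (C zero zero)))) ⟩
          D - p̂ * ι (C zero zero)                                ∎
          where
          regroup : ∀ q k c → + 1 ℤ.+ q ℤ.* (k ℤ.- c) ≡ (+ 1 ℤ.+ q ℤ.* k) ℤ.+ ℤ.- (q ℤ.* c)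
          regroup = solve-∀

        row₀ : ι e * v zero ≈ p̂ * S zero
        row₀ = begin
          ι e * v zero
            ≈⟨ *-congʳ ιe≈D-pC₀₀ ⟩
          (D - p̂ * c₀₀) * v zero
            ≈⟨ solve 4 (λ D p̂ C V → (D :- p̂ :* C) :* V := D :* V :- p̂ :* (C :* V)) refl D p̂ c₀₀ (v zero) ⟩
          D * v zero - p̂ * (c₀₀ * v zero)
            ≈⟨ +-congʳ (hyp zero) ⟩
          p̂ * (c₀₀ * v zero + S zero) - p̂ * (c₀₀ * v zero)
            ≈⟨ solve 3 (λ p̂ A S → p̂ :* (A :+ S) :- p̂ :* A := p̂ :* S) refl p̂ (c₀₀ * v zero) (S zero) ⟩
          p̂ * S zero                                                ∎
          where c₀₀ = ι (C zero zero)

        k′ : ℤ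
        k′ = (k ℤ.- C zero zero) ℤ.+ k ℤ.+ + p ℤ.* (k ℤ.- C zero zero) ℤ.* k

        C′ : Fin n → Fin n → ℤ
        C′ i j = C (suc i) zero ℤ.* + p ℤ.* C zero (suc j) ℤ.+ e ℤ.* C (suc i) (suc j)

        ∑C′v : ∀ i → ∑[ j < n ] (ι (C′ i j) * v (suc j)) ≈ ι (C (suc i) zero) * (p̂ * S zero) + ι e * S (suc i)
        ∑C′v i = begin
          ∑[ j < n ] (ι (C′ i j) * v (suc j))              ≈⟨ sum-cong-≋ expand ⟩
          ∑[ j < n ] (a * u j + ι e * w j)                 ≈⟨ ∑-distrib-+ (λ j → a * u j) (λ j → ι e * w j) ⟩
          ∑[ j < n ] (a * u j) + ∑[ j < n ] (ι e * w j)    ≈⟨ +-cong (*-distribˡ-sum a u) (*-distribˡ-sum (ι e) w) ⟨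
          a * S zero + ι e * S (suc i)                     ≈⟨ +-congʳ (*-assoc _ _ _) ⟩
          ι (C (suc i) zero) * (p̂ * S zero) + ι e * S (suc i) ∎
          where
          a = ι (C (suc i) zero) * p̂
          cᵢ₀p = C (suc i) zero ℤ.* + p
          u w : Vector Carrier n
          u j = ι (C zero (suc j)) * v (suc j)
          w j = ι (C (suc i) (suc j)) * v (suc j)
          expand : ∀ j → ι (C′ i j) * v (suc j) ≈ a * u j + ι e * w j
          expand j = begin
            ι (C′ i j) * v (suc j)
              ≈⟨ *-congʳ ιC′ ⟩
            (a * ι (C zero (suc j)) + ι e * ι (C (suc i) (suc j))) * v (suc j)
              ≈⟨ solve 5 (λ A B E F V → (A :* B :+ E :* F) :* V := A :* (B :* V) :+ E :* (F :* V)) refl a (ι (C zero (suc j))) (ι e) (ι (C (suc i) (suc j))) (v (suc j)) ⟩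
            a * u j + ι e * w j ∎
            where
            ιC′ : ι (C′ i j) ≈ a * ι (C zero (suc j)) + ι e * ι (C (suc i) (suc j))
            ιC′ = trans (ι-homo-+ (cᵢ₀p ℤ.* C zero (suc j)) (e ℤ.* C (suc i) (suc j)))
                        (+-cong (trans (ι-homo-* cᵢ₀p (C zero (suc j))) (*-congʳ (ι-homo-* (C (suc i) zero) (+ p))))
                                (ι-homo-* e (C (suc i) (suc j))))

        eliminated : ∀ i → ι (+ 1 ℤ.+ + p ℤ.* k′) * v (suc i) ≈ p̂ * ∑[ j < n ] (ι (C′ i j) * v (suc j))
        eliminated i = begin
          ι (+ 1 ℤ.+ + p ℤ.* k′) * v (suc i)
            ≈⟨ *-congʳ (reflexive (cong ι (product (+ p) (k ℤ.- C zero zero) k))) ⟩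
          ι (e ℤ.* (+ 1 ℤ.+ + p ℤ.* k)) * v (suc i)
            ≈⟨ trans (*-congʳ (ι-homo-* e (+ 1 ℤ.+ + p ℤ.* k))) (*-assoc _ _ _) ⟩
          ι e * (D * v (suc i))
            ≈⟨ *-congˡ (hyp (suc i)) ⟩
          ι e * (p̂ * (cᵢ₀ * v zero + S (suc i)))
            ≈⟨ solve 5 (λ E p̂ C V S → E :* (p̂ :* (C :* V :+ S)) := p̂ :* (C :* (E :* V) :+ E :* S)) refl (ι e) p̂ cᵢ₀ (v zero) (S (suc i)) ⟩
          p̂ * (cᵢ₀ * (ι e * v zero) + ι e * S (suc i))
            ≈⟨ *-congˡ (+-congʳ (*-congˡ row₀)) ⟩
          p̂ * (cᵢ₀ * (p̂ * S zero) + ι e * S (suc i))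
            ≈⟨ *-congˡ (∑C′v i) ⟨
          p̂ * ∑[ j < n ] (ι (C′ i j) * v (suc j))                       ∎
          where
          cᵢ₀ = ι (C (suc i) zero)
          product : ∀ q K k → + 1 ℤ.+ q ℤ.* (K ℤ.+ k ℤ.+ q ℤ.* K ℤ.* k) ≡ (+ 1 ℤ.+ q ℤ.* K) ℤ.* (+ 1 ℤ.+ q ℤ.* k)
          product = solve-∀

    [1+pk]v≈p∑Cv⇒v≈0 : ∀ {n} (v : Vector Carrier n) (C : Fin n → Fin n → ℤ) k →
      (∀ i → ι (+ 1 ℤ.+ + p ℤ.* k) * v i ≈ ιn p * ∑[ j < n ] (ι (C i j) * v j)) →
      ∀ i → v i ≈ 0#
    [1+pk]v≈p∑Cv⇒v≈0 {suc n} v C k hyp = v≈0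
      where
      open Step v C k hyp
      vₛ≈0 : ∀ i → v (suc i) ≈ 0#
      vₛ≈0 = [1+pk]v≈p∑Cv⇒v≈0 (λ i → v (suc i)) C′ k′ eliminated
      S₀≈0 : S zero ≈ 0#
      S₀≈0 = ∑≈0 _ (λ j → trans (*-congˡ (vₛ≈0 j)) (zeroʳ _))
      v≈0 : ∀ i → v i ≈ 0#
      v≈0 zero    = ι-cancelˡ e≢0 (trans row₀ (trans (*-congˡ S₀≈0) (zeroʳ p̂)))
      v≈0 (suc i) = vₛ≈0 i

  module RootOfUnity (ζ : Carrier) (n : ℕ) (ζ^[1+n]≈1 : ζ ^ suc n ≈ 1#) where
    open IntegerPolynomials ζ
    open ≈-Reasoning

    combination : (Fin (suc n) → ℤ) → Carrier
    combination d = ∑[ j < suc n ] (ι (d j) * ζ ^ toℕ j)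

    rotate : (Fin (suc n) → ℤ) → Fin (suc n) → ℤ
    rotate d zero    = d (fromℕ n)
    rotate d (suc j) = d (inject₁ j)

    ζ*combination : ∀ d → ζ * combination d ≈ combination (rotate d)
    ζ*combination d = begin
      ζ * combination d
        ≈⟨ *-congˡ (sum-init-last t) ⟩
      ζ * (∑[ j < n ] t (inject₁ j) + t (fromℕ n))
        ≈⟨ distribˡ ζ _ _ ⟩
      ζ * ∑[ j < n ] t (inject₁ j) + ζ * t (fromℕ n)
        ≈⟨ +-cong (*-distribˡ-sum ζ (λ j → t (inject₁ j))) shift-last ⟩
      ∑[ j < n ] (ζ * t (inject₁ j)) + ι (rotate d zero) * 1#
        ≈⟨ +-comm _ _ ⟩
      ι (rotate d zero) * 1# + ∑[ j < n ] (ζ * t (inject₁ j))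
        ≈⟨ +-congˡ (sum-cong-≋ shift-init) ⟩
      combination (rotate d)                                     ∎
      where
      t : Vector Carrier (suc n)
      t j = ι (d j) * ζ ^ toℕ j
      shift : ∀ a j → ζ * (a * ζ ^ j) ≈ a * ζ ^ suc j
      shift a j = solve 3 (λ Z A W → Z :* (A :* W) := A :* (Z :* W)) refl ζ a (ζ ^ j)
      shift-last : ζ * t (fromℕ n) ≈ ι (rotate d zero) * 1#
      shift-last = trans (shift (ι (d (fromℕ n))) (toℕ (fromℕ n)))
                         (*-congˡ (trans (reflexive (cong (λ j → ζ ^ suc j) (Fin.toℕ-fromℕ n))) ζ^[1+n]≈1))
      shift-init : ∀ j → ζ * t (inject₁ j) ≈ ι (rotate d (suc j)) * ζ ^ suc (toℕ j)
      shift-init j = trans (shift (ι (d (inject₁ j))) (toℕ (inject₁ j))) (*-congˡ (reflexive (cong (λ i → ζ ^ suc i) (Fin.toℕ-inject₁ j))))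

    ∈ℤ[ζ]⇒combination : ∀ {x} → x ∈ℤ[ζ] → ∃ λ d → x ≈ combination d
    ∈ℤ[ζ]⇒combination (cs , x≈cs) = proj₁ (horner cs) , trans x≈cs (proj₂ (horner cs))
      where
      horner : ∀ cs → ∃ λ d → ⟦ cs ⟧ℤ ≈ combination d
      horner []       = (λ _ → + 0) , sym (∑≈0 {suc n} (λ j → ι (+ 0) * ζ ^ toℕ j) (λ j → zeroˡ (ζ ^ toℕ j)))
      horner (a ∷ cs) with horner cs
      ... | d , cs≈d = d′ , (begin
        ι a + ζ * ⟦ cs ⟧ℤ
          ≈⟨ +-congˡ (trans (*-congˡ cs≈d) (ζ*combination d)) ⟩
        ι a + (ι (rotate d zero) * 1# + rest)
          ≈⟨ solve 3 (λ A B X → A :+ (B :* con (+ 1) :+ X) := (A :+ B) :* con (+ 1) :+ X) refl (ι a) (ι (rotate d zero)) rest ⟩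
        (ι a + ι (rotate d zero)) * 1# + rest
          ≈⟨ +-congʳ (*-congʳ (ι-homo-+ a (rotate d zero))) ⟨
        combination d′                                            ∎)
        where
        rest = ∑[ j < n ] (ι (rotate d (suc j)) * ζ ^ suc (toℕ j))
        d′ : Fin (suc n) → ℤ
        d′ zero    = a ℤ.+ rotate d zero
        d′ (suc j) = rotate d (suc j)

    module _ (p : ℕ) where
      open Congruence ζ p

      unit-ζ : Unitₚ ζ
      unit-ζ = ∈-ζ , ζ ^ n , ∈-^ ∈-ζ n , ≈⇒≡ₚ ζ^[1+n]≈1

    module _ (p : ℕ) (p≢1 : p ≢ 1) (1≉0 : ¬ 1# ≈ 0#) where
      open Congruence ζ p
      open Elimination p p≢1

      -- From 1 = p w, expanding each ζʲ w in the powers 1, ζ, …, ζⁿ gives ζʲ = p Σₗ Cⱼₗ ζˡ.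
      1≢ₚ0 : ¬ 1# ≡ₚ 0#
      1≢ₚ0 (w , w∈ , 1≈0+pw) = 1≉0 ([1+pk]v≈p∑Cv⇒v≈0 (λ j → ζ ^ toℕ j) C (+ 0) ζʲ≈p∑Cζ zero)
        where
        ζʲw∈ : ∀ j → ζ ^ toℕ j * w ∈ℤ[ζ]
        ζʲw∈ j = ∈-* (∈-^ ∈-ζ (toℕ j)) w∈
        C : Fin (suc n) → Fin (suc n) → ℤ
        C j = proj₁ (∈ℤ[ζ]⇒combination (ζʲw∈ j))
        ζʲ≈p∑Cζ : ∀ j → ι (+ 1 ℤ.+ + p ℤ.* + 0) * ζ ^ toℕ j ≈ ιn p * combination (C j)
        ζʲ≈p∑Cζ j = begin
          ι (+ 1 ℤ.+ + p ℤ.* + 0) * ζ ^ toℕ j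
            ≈⟨ *-congʳ (reflexive (cong (λ z → ι (+ 1 ℤ.+ z)) (ℤ.*-zeroʳ (+ p)))) ⟩
          1# * ζ ^ toℕ j
            ≈⟨ *-congʳ (trans 1≈0+pw (+-identityˡ _)) ⟩
          (ιn p * w) * ζ ^ toℕ j
            ≈⟨ solve 3 (λ P W Z → (P :* W) :* Z := P :* (Z :* W)) refl (ιn p) w (ζ ^ toℕ j) ⟩
          ιn p * (ζ ^ toℕ j * w)
            ≈⟨ *-congˡ (proj₂ (∈ℤ[ζ]⇒combination (ζʲw∈ j))) ⟩
          ιn p * combination (C j)              ∎

      ≡ₚunit⇒≉0 : ∀ {x u} → x ≡ₚ u → Unitₚ u → ¬ x ≈ 0#
      ≡ₚunit⇒≉0 {x} {u} x≡u (_ , t , t∈ , ut≡1) x≈0 =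
        1≢ₚ0 (≡ₚ-sym (≡ₚ-trans (≈⇒≡ₚ 0≈xt) (≡ₚ-trans (*-congʳₚ t∈ x≡u) ut≡1)))
        where
        0≈xt : 0# ≈ x * t
        0≈xt = sym (trans (*-congʳ x≈0) (zeroˡ t))

  -- A n = n! Pₙ(ζ) and V k n = n! Σ_{j ≤ n} g(k+j) P_{n−j}(ζ).  Clearing the denominators of the
  -- recursion turns it into A (n+1) = ζ V 1 n and V k (n+1) = g(k) A (n+1) + (n+1) V (k+1) n.
  module Sequence (g : ℕ → ℤ) (ζ : Carrier) where
    open Evaluation ζ
    open IntegerPolynomials ζ
    open ≈-Reasoning

    T : ℕ → ℕ → Carrier
    T k n = ⟦ weighted g k (toList (Ps g n)) ⟧

    A : ℕ → Carrier
    A n = ιn (n !) * ⟦ P g n ⟧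

    V : ℕ → ℕ → Carrier
    V k n = ιn (n !) * T k n

    ⟦P0⟧≈1 : ⟦ P g 0 ⟧ ≈ 1#
    ⟦P0⟧≈1 = trans (+-cong map-1 (zeroʳ ζ)) (+-identityʳ 1#)

    g-term : ∀ k n → ⟦ scale (g k / 1) (P g n) ⟧ ≈ ι (g k) * ⟦ P g n ⟧
    g-term k n = trans (eval-scale _ (P g n)) (*-congʳ (sym (ι≈φ∘fromℤ (g k))))

    T-zero : ∀ k → T k 0 ≈ ι (g k) * ⟦ P g 0 ⟧
    T-zero k = trans (eval-⊕ (scale (g k / 1) (P g 0)) []) (trans (+-identityʳ _) (g-term k 0))

    T-suc : ∀ k n → T k (suc n) ≈ ι (g k) * ⟦ P g (suc n) ⟧ + T (suc k) n
    T-suc k n = trans (eval-⊕ (scale (g k / 1) (P g (suc n))) (weighted g (suc k) (toList (Ps g n)))) (+-congʳ (g-term k (suc n)))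

    P-suc : ∀ n → ⟦ P g (suc n) ⟧ ≈ φ (+ 1 / suc n) * (ζ * T 1 n)
    P-suc n = trans (eval-scale (+ 1 / suc n) (X* w)) (*-congˡ (eval-X* w))
      where w = weighted g 1 (toList (Ps g n))

    A-zero : A 0 ≈ 1#
    A-zero = trans (*-identityˡ _) ⟦P0⟧≈1

    A-suc : ∀ n → A (suc n) ≈ ζ * V 1 n
    A-suc n = begin
      ιn (suc n !) * ⟦ P g (suc n) ⟧
        ≈⟨ *-cong (ιn-homo-* (suc n) (n !)) (P-suc n) ⟩
      (ιn (suc n) * ιn (n !)) * (φ (+ 1 / suc n) * (ζ * T 1 n))
        ≈⟨ solve 5 (λ N F Q Z T → (N :* F) :* (Q :* (Z :* T)) := (N :* Q) :* (Z :* (F :* T))) refl (ιn (suc n)) (ιn (n !)) (φ (+ 1 / suc n)) ζ (T 1 n) ⟩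
      (ιn (suc n) * φ (+ 1 / suc n)) * (ζ * V 1 n)
        ≈⟨ trans (*-congʳ (ιn[1+n]*φ[1/1+n]≈1 n)) (*-identityˡ _) ⟩
      ζ * V 1 n                                                 ∎

    V-zero : ∀ k → V k 0 ≈ ι (g k) * A 0
    V-zero k = trans (*-identityˡ _) (trans (T-zero k) (*-congˡ (sym (*-identityˡ _))))

    V-suc : ∀ k n → V k (suc n) ≈ ι (g k) * A (suc n) + ιn (suc n) * V (suc k) n
    V-suc k n = begin
      ιn (suc n !) * T k (suc n)
        ≈⟨ *-cong (ιn-homo-* (suc n) (n !)) (T-suc k n) ⟩
      (ιn (suc n) * ιn (n !)) * (ι (g k) * ⟦ P g (suc n) ⟧ + T (suc k) n)
        ≈⟨ solve 5 (λ N F G E T → (N :* F) :* (G :* E :+ T) := G :* ((N :* F) :* E) :+ N :* (F :* T)) refl (ιn (suc n)) (ιn (n !)) (ι (g k)) ⟦ P g (suc n) ⟧ (T (suc k) n) ⟩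
      ι (g k) * ((ιn (suc n) * ιn (n !)) * ⟦ P g (suc n) ⟧) + ιn (suc n) * V (suc k) n
        ≈⟨ +-congʳ (*-congˡ (*-congʳ (ιn-homo-* (suc n) (n !)))) ⟨
      ι (g k) * A (suc n) + ιn (suc n) * V (suc k) n               ∎

    -- At n = 0 the junk term V (k+1) (0 ∸ 1) is multiplied by ιn 0.
    V-step : ∀ k n → V k n ≈ ι (g k) * A n + ιn n * V (suc k) (n ℕ.∸ 1)
    V-step k zero    = trans (V-zero k) (sym (trans (+-congˡ (zeroˡ _)) (+-identityʳ _)))
    V-step k (suc n) = V-suc k n

    P≈0⇒A≈0 : ∀ n → ⟦ P g n ⟧ ≈ 0# → A n ≈ 0#
    P≈0⇒A≈0 n P≈0 = trans (*-congˡ P≈0) (zeroʳ _)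

    A∈ : ∀ n → A n ∈ℤ[ζ]
    V∈ : ∀ k n → V k n ∈ℤ[ζ]
    A∈ zero    = ∈-resp-≈ (sym A-zero) ∈-1
    A∈ (suc n) = ∈-resp-≈ (sym (A-suc n)) (∈-ζ* (V∈ 1 n))
    V∈ k zero    = ∈-resp-≈ (sym (V-zero k)) (∈-ι* (g k) (A∈ 0))
    V∈ k (suc n) = ∈-resp-≈ (sym (V-suc k n)) (∈-+ (∈-ι* (g k) (A∈ (suc n))) (∈-ι* (+ suc n) (V∈ (suc k) n)))

    A-suc-expand : g 1 ≡ + 1 → ∀ n → let n₁ = n ℕ.∸ 1 ; n₂ = n₁ ℕ.∸ 1 in
      A (suc n) ≈ ζ * (A n + ι (g 2) * (ιn n * A n₁) + ι (g 3) * (ιn (n ℕ.* n₁) * A n₂)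
                       + ιn (n ℕ.* n₁ ℕ.* n₂) * V 4 (n₂ ℕ.∸ 1))
    A-suc-expand g1≡1 n = begin
      A (suc n)
        ≈⟨ A-suc n ⟩
      ζ * V 1 n
        ≈⟨ *-congˡ (V-step 1 n) ⟩
      ζ * (ι (g 1) * A n + N₀ * V 2 n₁)
        ≈⟨ *-congˡ (+-cong (*-congʳ (reflexive (cong ι g1≡1))) (*-congˡ (V-step 2 n₁))) ⟩
      ζ * (1# * A n + N₀ * (ι (g 2) * A n₁ + N₁ * V 3 n₂))
        ≈⟨ *-congˡ (+-congˡ (*-congˡ (+-congˡ (*-congˡ (V-step 3 n₂))))) ⟩
      ζ * (1# * A n + N₀ * (ι (g 2) * A n₁ + N₁ * (ι (g 3) * A n₂ + N₂ * W)))
        ≈⟨ solve 10 (λ Z A₀ A₁ A₂ G₂ G₃ N₀ N₁ N₂ W →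
                       Z :* (con (+ 1) :* A₀ :+ N₀ :* (G₂ :* A₁ :+ N₁ :* (G₃ :* A₂ :+ N₂ :* W)))
                    := Z :* (A₀ :+ G₂ :* (N₀ :* A₁) :+ G₃ :* ((N₀ :* N₁) :* A₂) :+ ((N₀ :* N₁) :* N₂) :* W))
                 refl ζ (A n) (A n₁) (A n₂) (ι (g 2)) (ι (g 3)) N₀ N₁ N₂ W ⟩
      ζ * (A n + ι (g 2) * (N₀ * A n₁) + ι (g 3) * ((N₀ * N₁) * A n₂) + ((N₀ * N₁) * N₂) * W)
        ≈⟨ *-congˡ (+-cong (+-congˡ (*-congˡ (*-congʳ (sym (ιn-homo-* n n₁)))))
                           (*-congʳ (trans (*-congʳ (sym (ιn-homo-* n n₁))) (sym (ιn-homo-* (n ℕ.* n₁) n₂))))) ⟩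
      ζ * (A n + ι (g 2) * (ιn n * A n₁) + ι (g 3) * (ιn (n ℕ.* n₁) * A n₂) + ιn (n ℕ.* n₁ ℕ.* n₂) * W) ∎
      where
      n₁ = n ℕ.∸ 1
      n₂ = n₁ ℕ.∸ 1
      N₀ = ιn n
      N₁ = ιn n₁
      N₂ = ιn n₂
      W = V 4 (n₂ ℕ.∸ 1)

  module SequenceModulo (g : ℕ → ℤ) (g1≡1 : g 1 ≡ + 1) (ζ : Carrier) (p : ℕ) .{{_ : NonZero p}} where
    open IntegerPolynomials ζ
    open Congruence ζ p
    open ≡ₚ-Reasoning
    open Sequence g ζ public

    e₂ e₃ : ℕ
    e₂ = g 2 %ℕ p
    e₃ = g 3 %ℕ p

    A-suc-≡ₚ : ∀ n → let n₁ = n ℕ.∸ 1 ; n₂ = n₁ ℕ.∸ 1 in p ∣ n ℕ.* n₁ ℕ.* n₂ →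
      A (suc n) ≡ₚ ζ * (A n + ι (g 2) * (ιn n * A n₁) + ι (g 3) * (ιn (n ℕ.* n₁) * A n₂))
    A-suc-≡ₚ n p∣n₀n₁n₂ = begin
      A (suc n)                 ≈⟨ A-suc-expand g1≡1 n ⟩
      ζ * (S + ιn N * V 4 n₃)   ≲⟨ *-congˡₚ ∈-ζ (+-congₚ ≡ₚ-refl (p∣n⇒ιn*≡ₚ0 p∣n₀n₁n₂ (V∈ 4 n₃))) ⟩
      ζ * (S + 0#)              ≈⟨ *-congˡ (+-identityʳ S) ⟩
      ζ * S                     ∎
      where
      n₁ = n ℕ.∸ 1
      n₂ = n₁ ℕ.∸ 1
      n₃ = n₂ ℕ.∸ 1
      N = n ℕ.* n₁ ℕ.* n₂
      S = A n + ι (g 2) * (ιn n * A n₁) + ι (g 3) * (ιn (n ℕ.* n₁) * A n₂)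

    A[1+kp]≡ₚ : ∀ k → A (1 ℕ.+ k ℕ.* p) ≡ₚ ζ * A (k ℕ.* p)
    A[1+kp]≡ₚ k = begin
      A (1 ℕ.+ kp)
        ≲⟨ A-suc-≡ₚ kp (∣m⇒∣m*n (kp ℕ.∸ 1 ℕ.∸ 1) (∣m⇒∣m*n (kp ℕ.∸ 1) (n∣m*n k))) ⟩
      ζ * (A kp + ι (g 2) * (ιn kp * A (kp ℕ.∸ 1)) + ι (g 3) * (ιn (kp ℕ.* (kp ℕ.∸ 1)) * A (kp ℕ.∸ 1 ℕ.∸ 1)))
        ≲⟨ *-congˡₚ ∈-ζ (+-congₚ (+-congₚ ≡ₚ-refl (*-congˡₚ (∈-ι (g 2)) (p∣n⇒ιn*≡ₚ0 (n∣m*n k) (A∈ (kp ℕ.∸ 1)))))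
                                 (*-congˡₚ (∈-ι (g 3)) (p∣n⇒ιn*≡ₚ0 (∣m⇒∣m*n (kp ℕ.∸ 1) (n∣m*n k)) (A∈ (kp ℕ.∸ 1 ℕ.∸ 1))))) ⟩
      ζ * (A kp + ι (g 2) * 0# + ι (g 3) * 0#)
        ≈⟨ solve 4 (λ Z A G₂ G₃ → Z :* (A :+ G₂ :* con (+ 0) :+ G₃ :* con (+ 0)) := Z :* A) refl ζ (A kp) (ι (g 2)) (ι (g 3)) ⟩
      ζ * A kp                      ∎
      where kp = k ℕ.* p

    A[2+kp]≡ₚ : ∀ k → A (2 ℕ.+ k ℕ.* p) ≡ₚ ζ * (A (1 ℕ.+ k ℕ.* p) + ιn e₂ * A (k ℕ.* p))
    A[2+kp]≡ₚ k = begin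
      A (2 ℕ.+ kp)
        ≲⟨ A-suc-≡ₚ (1 ℕ.+ kp) (∣m⇒∣m*n (kp ℕ.∸ 1) (∣n⇒∣m*n (1 ℕ.+ kp) (n∣m*n k))) ⟩
      ζ * (A (1 ℕ.+ kp) + ι (g 2) * (ιn (1 ℕ.+ kp) * A kp) + ι (g 3) * (ιn ((1 ℕ.+ kp) ℕ.* kp) * A (kp ℕ.∸ 1)))
        ≲⟨ *-congˡₚ ∈-ζ (+-congₚ (+-congₚ ≡ₚ-refl (ιa*ιn[r+kp]≡ₚ (g 2) 1 k (A∈ kp)))
                                 (*-congˡₚ (∈-ι (g 3)) (p∣n⇒ιn*≡ₚ0 (∣n⇒∣m*n (1 ℕ.+ kp) (n∣m*n k)) (A∈ (kp ℕ.∸ 1))))) ⟩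
      ζ * (A (1 ℕ.+ kp) + ιn e₂ * (1# * A kp) + ι (g 3) * 0#)
        ≈⟨ solve 5 (λ Z A₁ A₀ E G → Z :* (A₁ :+ E :* (con (+ 1) :* A₀) :+ G :* con (+ 0)) := Z :* (A₁ :+ E :* A₀)) refl ζ (A (1 ℕ.+ kp)) (A kp) (ιn e₂) (ι (g 3)) ⟩
      ζ * (A (1 ℕ.+ kp) + ιn e₂ * A kp) ∎
      where kp = k ℕ.* p

    A[3+kp]≡ₚ : ∀ k → A (3 ℕ.+ k ℕ.* p) ≡ₚ
      ζ * (A (2 ℕ.+ k ℕ.* p) + ιn e₂ * (ιn 2 * A (1 ℕ.+ k ℕ.* p)) + ιn e₃ * (ιn 2 * A (k ℕ.* p)))
    A[3+kp]≡ₚ k = begin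
      A (3 ℕ.+ kp)
        ≲⟨ A-suc-≡ₚ (2 ℕ.+ kp) (∣n⇒∣m*n ((2 ℕ.+ kp) ℕ.* (1 ℕ.+ kp)) (n∣m*n k)) ⟩
      ζ * (A (2 ℕ.+ kp) + ι (g 2) * (ιn (2 ℕ.+ kp) * A (1 ℕ.+ kp)) + ι (g 3) * (ιn ((2 ℕ.+ kp) ℕ.* (1 ℕ.+ kp)) * A kp))
        ≈⟨ *-congˡ (+-congˡ (*-congˡ (*-congʳ (reflexive (cong ιn (expand k p)))))) ⟩
      ζ * (A (2 ℕ.+ kp) + ι (g 2) * (ιn (2 ℕ.+ kp) * A (1 ℕ.+ kp)) + ι (g 3) * (ιn (2 ℕ.+ (3 ℕ.* k ℕ.+ k ℕ.* kp) ℕ.* p) * A kp))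
        ≲⟨ *-congˡₚ ∈-ζ (+-congₚ (+-congₚ ≡ₚ-refl (ιa*ιn[r+kp]≡ₚ (g 2) 2 k (A∈ (1 ℕ.+ kp))))
                                 (ιa*ιn[r+kp]≡ₚ (g 3) 2 (3 ℕ.* k ℕ.+ k ℕ.* kp) (A∈ kp))) ⟩
      ζ * (A (2 ℕ.+ kp) + ιn e₂ * (ιn 2 * A (1 ℕ.+ kp)) + ιn e₃ * (ιn 2 * A kp)) ∎
      where
      kp = k ℕ.* p
      expand : ∀ k p → (2 ℕ.+ k ℕ.* p) ℕ.* (1 ℕ.+ k ℕ.* p) ≡ 2 ℕ.+ (3 ℕ.* k ℕ.+ k ℕ.* (k ℕ.* p)) ℕ.* p
      expand = ℕ-Solver.solve-∀

    module _ (k : ℕ) {Y} (A[kp]≡ₚY : A (k ℕ.* p) ≡ₚ Y) where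
      A[1+kp]≡ₚζY : A (1 ℕ.+ k ℕ.* p) ≡ₚ ζ * Y
      A[1+kp]≡ₚζY = ≡ₚ-trans (A[1+kp]≡ₚ k) (*-congˡₚ ∈-ζ A[kp]≡ₚY)

      A[2+kp]≡ₚζ[ζ+e₂]Y : A (2 ℕ.+ k ℕ.* p) ≡ₚ ζ * (ζ + ιn e₂) * Y
      A[2+kp]≡ₚζ[ζ+e₂]Y = begin
        A (2 ℕ.+ k ℕ.* p)
          ≲⟨ A[2+kp]≡ₚ k ⟩
        ζ * (A (1 ℕ.+ k ℕ.* p) + ιn e₂ * A (k ℕ.* p))
          ≲⟨ *-congˡₚ ∈-ζ (+-congₚ A[1+kp]≡ₚζY (*-congˡₚ (∈-ι (+ e₂)) A[kp]≡ₚY)) ⟩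
        ζ * (ζ * Y + ιn e₂ * Y)
          ≈⟨ solve 3 (λ Z E Y → Z :* (Z :* Y :+ E :* Y) := Z :* (Z :+ E) :* Y) refl ζ (ιn e₂) Y ⟩
        ζ * (ζ + ιn e₂) * Y                             ∎

  module _ (g : ℕ → ℤ) (g1≡1 : g 1 ≡ + 1) (ζ : Carrier) where
    open IntegerPolynomials ζ

    module Modulo2 where
      open Congruence ζ 2
      open SequenceModulo g g1≡1 ζ 2

      W : Carrier
      W = ζ * (ζ + ιn e₂)

      A[2k]≡ₚWᵏ : ∀ k → A (k ℕ.* 2) ≡ₚ W ^ k
      A[2k]≡ₚWᵏ zero    = ≈⇒≡ₚ A-zero
      A[2k]≡ₚWᵏ (suc k) = A[2+kp]≡ₚζ[ζ+e₂]Y k (A[2k]≡ₚWᵏ k)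

    module Modulo3 where
      open Congruence ζ 3
      open ≡ₚ-Reasoning
      open SequenceModulo g g1≡1 ζ 3

      U : Carrier
      U = ζ * (ζ ^ 2 - ιn e₃)

      A[3k]≡ₚUᵏ : ∀ k → A (k ℕ.* 3) ≡ₚ U ^ k
      A[3k]≡ₚUᵏ zero    = ≈⇒≡ₚ A-zero
      A[3k]≡ₚUᵏ (suc k) = begin
        A (3 ℕ.+ k ℕ.* 3)
          ≲⟨ A[3+kp]≡ₚ k ⟩
        ζ * (A (2 ℕ.+ k ℕ.* 3) + ιn e₂ * (ιn 2 * A (1 ℕ.+ k ℕ.* 3)) + ιn e₃ * (ιn 2 * A (k ℕ.* 3)))
          ≲⟨ *-congˡₚ ∈-ζ (+-congₚ (+-congₚ (A[2+kp]≡ₚζ[ζ+e₂]Y k IH) (*-congˡₚ (∈-ι (+ e₂)) (*-congˡₚ (∈-ι (+ 2)) (A[1+kp]≡ₚζY k IH))))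
                                   (*-congˡₚ (∈-ι (+ e₃)) (*-congˡₚ (∈-ι (+ 2)) IH))) ⟩
        ζ * (ζ * (ζ + ιn e₂) * Uᵏ + ιn e₂ * (ιn 2 * (ζ * Uᵏ)) + ιn e₃ * (ιn 2 * Uᵏ))
          ≲⟨ multiple-of-3 ⟩
        U * Uᵏ                                         ∎
        where
        IH = A[3k]≡ₚUᵏ k
        Uᵏ = U ^ k
        U∈ : U ∈ℤ[ζ]
        U∈ = ∈-* ∈-ζ (∈-+ (∈-^ ∈-ζ 2) (∈-neg (∈-ι (+ e₃))))
        multiple-of-3 : ζ * (ζ * (ζ + ιn e₂) * Uᵏ + ιn e₂ * (ιn 2 * (ζ * Uᵏ)) + ιn e₃ * (ιn 2 * Uᵏ)) ≡ₚ U * Uᵏ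
        multiple-of-3 = ζ * Uᵏ * (ιn e₂ * ζ + ιn e₃) , ∈-* (∈-* ∈-ζ (∈-^ U∈ k)) (∈-+ (∈-ι* (+ e₂) ∈-ζ) (∈-ι (+ e₃))) ,
          solve 4 (λ Z E C X →
              Z :* (Z :* (Z :+ E) :* X :+ E :* (con (+ 2) :* (Z :* X)) :+ C :* (con (+ 2) :* X))
            := (Z :* (Z :^ 2 :- C)) :* X :+ con (+ 3) :* (Z :* X :* (E :* Z :+ C))) refl ζ (ιn e₂) (ιn e₃) Uᵏ

    module NonVanishing (n : ℕ) (ζ^[1+n]≈1 : ζ ^ suc n ≈ 1#) (1≉0 : ¬ 1# ≈ 0#)
                        (p : ℕ) .{{_ : NonZero p}} (p≢1 : p ≢ 1) (p≤3 : p ≤ 3) where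
      open Congruence ζ p
      open SequenceModulo g g1≡1 ζ p
      open RootOfUnity ζ n ζ^[1+n]≈1

      module _ {X} (uX : Unitₚ X) (A[kp]≡ₚXᵏ : ∀ k → A (k ℕ.* p) ≡ₚ X ^ k) (uζ+e₂ : Unitₚ (ζ + ιn e₂)) where
        A[r+kp]≡ₚunit : ∀ r k → r < p → ∃ λ u → Unitₚ u × A (r ℕ.+ k ℕ.* p) ≡ₚ u
        A[r+kp]≡ₚunit 0 k _ = X ^ k , unit-^ uX k , A[kp]≡ₚXᵏ k
        A[r+kp]≡ₚunit 1 k _ = ζ * X ^ k , unit-* (unit-ζ p) (unit-^ uX k) , A[1+kp]≡ₚζY k (A[kp]≡ₚXᵏ k)
        A[r+kp]≡ₚunit 2 k _ = ζ * (ζ + ιn e₂) * X ^ k , unit-* (unit-* (unit-ζ p) uζ+e₂) (unit-^ uX k) ,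
                              A[2+kp]≡ₚζ[ζ+e₂]Y k (A[kp]≡ₚXᵏ k)
        A[r+kp]≡ₚunit (suc (suc (suc r))) k r<p = contradiction (ℕ.<-≤-trans r<p p≤3) λ { (s≤s (s≤s (s≤s ()))) }

        A≉0 : ∀ m → ¬ A m ≈ 0#
        A≉0 m A≈0 with A[r+kp]≡ₚunit (m ℕ.% p) (m ℕ./ p) (ℕ.m%n<n m p)
        ... | u , u-unit , A≡ₚu =
          ≡ₚunit⇒≉0 p p≢1 1≉0 A≡ₚu u-unit (trans (reflexive (cong A (≡.sym (ℕ.m≡m%n+[m/n]*n m p)))) A≈0)

  module PrimitiveRoot (dom : IsIntegralDomain R) (ζ : Carrier) (n : ℕ) (ζ-primitive : IsPrimitiveRoot R (suc n) ζ) where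
    open IsIntegralDomain dom using (1≉0)
    open Evaluation ζ using (⟦_⟧)
    open ≈-Reasoning

    pow≈^ : ∀ x k → pow R x k ≈ x ^ k
    pow≈^ x zero    = refl
    pow≈^ x (suc k) = *-congˡ (pow≈^ x k)

    ζ^[1+n]≈1 : ζ ^ suc n ≈ 1#
    ζ^[1+n]≈1 = trans (sym (pow≈^ ζ (suc n))) (proj₁ ζ-primitive)

    ζ^[[1+n]k]≈1 : ∀ k → ζ ^ (suc n ℕ.* k) ≈ 1#
    ζ^[[1+n]k]≈1 k = trans (sym (^-assocʳ ζ (suc n) k)) (trans (^-congˡ k ζ^[1+n]≈1) (1^k≈1 k))
      where
      1^k≈1 : ∀ k → 1# ^ k ≈ 1#
      1^k≈1 zero    = refl
      1^k≈1 (suc k) = trans (*-identityˡ _) (1^k≈1 k)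

    [ζ²]ᴺ≉1 : ∀ N → 0 < N → 2 ℕ.* N < suc n → ¬ (ζ ^ 2) ^ N ≈ 1#
    [ζ²]ᴺ≉1 N 0<N 2N<1+n [ζ²]ᴺ≈1 = proj₂ ζ-primitive (2 ℕ.* N) (ℕ.≤-trans 0<N (ℕ.m≤n*m N 2)) 2N<1+n
      (trans (pow≈^ ζ (2 ℕ.* N)) (trans (sym (^-assocʳ ζ 2 N)) [ζ²]ᴺ≈1))

    [[ζ²]ᴺ]^q≈1 : ∀ N q k → 2 ℕ.* N ℕ.* q ≡ suc n ℕ.* k → ((ζ ^ 2) ^ N) ^ q ≈ 1#
    [[ζ²]ᴺ]^q≈1 N q k 2Nq≡[1+n]k = begin
      ((ζ ^ 2) ^ N) ^ q        ≈⟨ ^-congˡ q (^-assocʳ ζ 2 N) ⟩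
      (ζ ^ (2 ℕ.* N)) ^ q      ≈⟨ ^-assocʳ ζ (2 ℕ.* N) q ⟩
      ζ ^ (2 ℕ.* N ℕ.* q)      ≈⟨ reflexive (cong (ζ ^_) 2Nq≡[1+n]k) ⟩
      ζ ^ (suc n ℕ.* k)        ≈⟨ ζ^[[1+n]k]≈1 k ⟩
      1#                       ∎

    module _ (g : ℕ → ℤ) (g1≡1 : g 1 ≡ + 1) where
      P≉0-modulo2 : ∀ j s → suc n ≡ 2 ℕ.^ j ℕ.* suc (2 ℕ.* suc s) → ∀ m → ¬ ⟦ P g m ⟧ ≈ 0#
      P≉0-modulo2 j s 1+n≡Nq m P≈0 = A≉0 (unit-* (unit-ζ 2) uζ+e₂) A[2k]≡ₚWᵏ uζ+e₂ m (P≈0⇒A≈0 m P≈0)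
        where
        open Congruence ζ 2
        open SequenceModulo g g1≡1 ζ 2 using (e₂; P≈0⇒A≈0)
        open Modulo2 g g1≡1 ζ
        open NonVanishing g g1≡1 ζ n ζ^[1+n]≈1 1≉0 2 (λ ()) (s≤s (s≤s z≤n))
        open RootOfUnity ζ n ζ^[1+n]≈1 using (unit-ζ)
        N = 2 ℕ.^ j
        q = suc (2 ℕ.* suc s)
        2N<1+n : 2 ℕ.* N < suc n
        2N<1+n = ≡.subst₂ _<_ (ℕ.*-comm N 2) (≡.sym 1+n≡Nq) (ℕ.*-monoʳ-< N {{ℕ.m^n≢0 2 j}} (s≤s (ℕ.*-monoʳ-≤ 2 (s≤s z≤n))))
        2Nq≡[1+n]2 : 2 ℕ.* N ℕ.* q ≡ suc n ℕ.* 2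
        2Nq≡[1+n]2 = ≡.trans (reorder N q) (cong (ℕ._* 2) (≡.sym 1+n≡Nq))
          where
          reorder : ∀ N q → 2 ℕ.* N ℕ.* q ≡ N ℕ.* q ℕ.* 2
          reorder = ℕ-Solver.solve-∀
        q*1≡1+[1+s]2 : q ℕ.* 1 ≡ 1 ℕ.+ suc s ℕ.* 2
        q*1≡1+[1+s]2 = odd (suc s)
          where
          odd : ∀ s → suc (2 ℕ.* s) ℕ.* 1 ≡ 1 ℕ.+ s ℕ.* 2
          odd = ℕ-Solver.solve-∀
        u1+ζ : Unitₚ (1# + ζ)
        u1+ζ = proj₁ (unit-1±ζ dom N q 1 (suc s) ([ζ²]ᴺ≉1 N (ℕ.m^n>0 2 j) 2N<1+n)
                                                  ([[ζ²]ᴺ]^q≈1 N q 2 2Nq≡[1+n]2) q*1≡1+[1+s]2)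
        uζ+e₂ : Unitₚ (ζ + ιn e₂)
        uζ+e₂ = unit-ζ+ιn (ℤ.n%ℕd<d (g 2) 2) (unit-ζ 2) u1+ζ

      P≉0-modulo3 : ∀ i → suc n ≡ 2 ℕ.^ (2 ℕ.+ i) → g 3 %ℕ 3 ≡ 0 ⊎ g 3 %ℕ 3 ≡ 1 → ∀ m → ¬ ⟦ P g m ⟧ ≈ 0#
      P≉0-modulo3 i 1+n≡4N e₃≤1 m P≈0 =
        A≉0 (unit-* (unit-ζ 3) (uζ²-ιn e₃ e₃≤1)) A[3k]≡ₚUᵏ (uζ+ιn e₂ (ℤ.n%ℕd<d (g 2) 3)) m (P≈0⇒A≈0 m P≈0)
        where
        open Congruence ζ 3
        open IntegerPolynomials ζ
        open SequenceModulo g g1≡1 ζ 3 using (e₂; e₃; P≈0⇒A≈0)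
        open Modulo3 g g1≡1 ζ
        open NonVanishing g g1≡1 ζ n ζ^[1+n]≈1 1≉0 3 (λ ()) ℕ.≤-refl
        open RootOfUnity ζ n ζ^[1+n]≈1 using (unit-ζ)
        N = 2 ℕ.^ i
        2N<1+n : 2 ℕ.* N < suc n
        2N<1+n = ≡.subst₂ _<_ ≡.refl (≡.sym 1+n≡4N)
          (≡.subst (2 ℕ.* N <_) (ℕ.*-comm (2 ℕ.* N) 2) (ℕ.m<m*n (2 ℕ.* N) 2 {{ℕ.m*n≢0 2 N {{_}} {{ℕ.m^n≢0 2 i}}}} (s≤s (s≤s z≤n))))
        2N2≡[1+n]1 : 2 ℕ.* N ℕ.* 2 ≡ suc n ℕ.* 1
        2N2≡[1+n]1 = ≡.trans (reorder N) (cong (ℕ._* 1) (≡.sym 1+n≡4N))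
          where
          reorder : ∀ N → 2 ℕ.* N ℕ.* 2 ≡ 2 ℕ.* (2 ℕ.* N) ℕ.* 1
          reorder = ℕ-Solver.solve-∀
        u1±ζ : Unitₚ (1# + ζ) × Unitₚ (1# - ζ)
        u1±ζ = unit-1±ζ dom N 2 2 1 ([ζ²]ᴺ≉1 N (ℕ.m^n>0 2 i) 2N<1+n) ([[ζ²]ᴺ]^q≈1 N 2 1 2N2≡[1+n]1) ≡.refl
        uζ+ιn : ∀ e → e < 3 → Unitₚ (ζ + ιn e)
        uζ+ιn 0 _ = unit-ζ+ιn (s≤s z≤n) (unit-ζ 3) (proj₁ u1±ζ)
        uζ+ιn 1 _ = unit-ζ+ιn (s≤s (s≤s z≤n)) (unit-ζ 3) (proj₁ u1±ζ)
        uζ+ιn 2 _ = unit-resp-≡ₚ (∈-+ ∈-ζ (∈-ι (+ 2))) (- 1# , ∈-neg ∈-1 , ζ-1≈ζ+2-3) (unit-neg (proj₂ u1±ζ))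
          where
          ζ-1≈ζ+2-3 : - (1# - ζ) ≈ (ζ + ιn 2) + ιn 3 * - 1#
          ζ-1≈ζ+2-3 = solve 1 (λ Z → :- (con (+ 1) :- Z) := (Z :+ con (+ 2)) :+ con (+ 3) :* (:- con (+ 1))) refl ζ
        uζ+ιn (suc (suc (suc _))) (s≤s (s≤s (s≤s ())))
        uζ²-ιn : ∀ c → c ≡ 0 ⊎ c ≡ 1 → Unitₚ (ζ ^ 2 - ιn c)
        uζ²-ιn .0 (inj₁ ≡.refl) = unit-resp-≈ (solve 1 (λ Z → Z :^ 2 := Z :^ 2 :- con (+ 0)) refl ζ) (unit-^ (unit-ζ 3) 2)
        uζ²-ιn .1 (inj₂ ≡.refl) = unit-resp-≈ (solve 1 (λ Z → :- ((con (+ 1) :+ Z) :* (con (+ 1) :- Z)) := Z :^ 2 :- con (+ 1)) refl ζ)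
                                              (unit-neg (unit-* (proj₁ u1±ζ) (proj₂ u1±ζ)))

      P≉0 : g 3 %ℕ 3 ≡ 0 ⊎ g 3 %ℕ 3 ≡ 1 → 3 ≤ suc n → ∀ m → ¬ ⟦ P g m ⟧ ≈ 0#
      P≉0 e₃≤1 3≤1+n with 2-adic n
      ... | j           , suc s , 1+n≡ = P≉0-modulo2 j s 1+n≡
      ... | 0           , 0     , 1+n≡ = contradiction (≡.subst (3 ≤_) 1+n≡ 3≤1+n) λ { (s≤s ()) }
      ... | 1           , 0     , 1+n≡ = contradiction (≡.subst (3 ≤_) 1+n≡ 3≤1+n) λ { (s≤s (s≤s ())) }
      ... | suc (suc i) , 0     , 1+n≡ = P≉0-modulo3 i (≡.trans 1+n≡ (ℕ.*-identityʳ _)) e₃≤1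

theorem3 : (g : ℕ → ℤ) → g 1 ≡ + 1 → (g 3 %ℕ 3 ≡ 0 ⊎ g 3 %ℕ 3 ≡ 1) →
    {c ℓ : Level} (R : CommutativeRing c ℓ) → IsIntegralDomain R →
    (φ : ℚ-to R) → IsRingHomℚ R φ →
    (m : ℕ) → 3 ≤ m → (ζ : CommutativeRing.Carrier R) → IsPrimitiveRoot R m ζ →
    (n : ℕ) → ¬ (CommutativeRing._≈_ R (eval R φ (P g n) ζ) (CommutativeRing.0# R))
theorem3 g g1≡1 e₃≤1 R dom φ φ-hom (suc m) 3≤1+m ζ ζ-primitive =
  PrimitiveRoot.P≉0 R φ φ-hom dom ζ m ζ-primitive g g1≡1 e₃≤1 3≤1+m
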